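{- Let $n\ge1$ and $S\subseteq\{1,\dots,n\}$. Put $S'=\emptyset$ if $S=\emptyset$ and $S'=S\setminus\{\max S\}$ otherwise. Then $m_n^+(S)=S'\cup\{n\}$.
   Context: Let $[k,n]=\{k,\dots,n\}$. $\mathcal{L}_n$ is the set of subsets of $\{1,\dots,n\}$ with $I\le_n J$ iff $\#(I\cap[k,n])\le\#(J\cap[k,n])$ for all $k$. $m_n^+(S)$ denotes the minimum element (with respect to $\le_n$) of the set $\{U\in\mathcal{L}_n : n\in U,\ S\le_nU\}$. -}

module Defs where

open import Data.Nat using (ℕ; suc; _≤_; _≤ᵇ_)
open import Data.Fin using (Fin; toℕ; fromℕ; _≤_)
open import Data.Fin.Subset using (Subset; ⁅_⁆; _∈_; _∩_; _∪_; _-_; ∣_∣; ⊥)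
open import Data.Vec using (tabulate)
open import Data.Product using (Σ; _×_)
open import Data.Sum using (_⊎_)
open import Relation.Binary.PropositionalEquality using (_≡_)

-- Convention: a subset of {1,…,n} is a  Subset n ; the element  i : Fin n
-- represents the integer  toℕ i + 1.

interval : ∀ {n} → ℕ → Subset n
interval k = tabulate (λ i → k ≤ᵇ suc (toℕ i))

countFrom : ∀ {n} → ℕ → Subset n → ℕ
countFrom k I = ∣ I ∩ interval k ∣

_≤L_ : ∀ {n} → Subset n → Subset n → Set
I ≤L J = ∀ (k : ℕ) → countFrom k I Data.Nat.≤ countFrom k J

IsMinimum : ∀ {n} → (Subset n → Set) → Subset n → Set
IsMinimum P U = P U × (∀ V → P V → U ≤L V)

-- The element n of {1,…,n} (n ≥ 1, written as suc n here)
topElem : ∀ n → Fin (suc n)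
topElem n = fromℕ n

IsMax : ∀ {n} → Subset n → Fin n → Set
IsMax S m = m ∈ S × (∀ x → x ∈ S → x Data.Fin.≤ m)

IsPrimeOf : ∀ {n} → Subset n → Subset n → Set
IsPrimeOf S S' = (S ≡ ⊥ × S' ≡ ⊥) ⊎ Σ _ (λ m → IsMax S m × S' ≡ S - m)

Above : ∀ n → Subset (suc n) → Subset (suc n) → Set
Above n S U = topElem n ∈ U × S ≤L U

module Submission where

-- Write U = S' ∪ {n} and I_k = [k,n].  The proof rests on a criterion for
-- being the minimum of  Above n S = {U : n ∈ U, S ≤_n U}:  if U = T ∪ {n}
-- with T ⊆ S, and for every k either #(S ∩ I_k) = #(U ∩ I_k) or S ∩ I_k is
-- empty, then U is that minimum.  Indeed S ≤_n U is immediate, and for a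
-- competitor V ∋ n the first kind of k is handled by S ≤_n V, while for the
-- second kind U ∩ I_k ⊆ {n} ⊆ V, so #(U ∩ I_k) ≤ #(V ∩ I_k).
--
-- For S = ∅ every k is of the second kind.  For S with maximum m, the
-- windows I_k with k ≤ m contain m and n, and U arises from S by exchanging
-- m for n, which preserves #(· ∩ I_k); the windows with k > m miss S.

open import Defs
open import Data.Bool.Properties using (T-≡)
open import Data.Empty using (⊥-elim)
open import Data.Fin using (Fin; toℕ; _≟_)
open import Data.Fin.Properties using (≤fromℕ; ≤-antisym)
open import Data.Fin.Subset using (Subset; ⁅_⁆; _∪_; _∩_; _∈_; _∉_; _⊆_; _-_; ∣_∣; ⊥; Empty; inside; outside)
open import Data.Fin.Subset.Properties
open import Data.Nat using (ℕ; suc; _≤_; _≤?_; z≤n; s≤s)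
open import Data.Nat.Properties using (≤ᵇ⇒≤; ≤⇒≤ᵇ; ≤-trans; ≤-reflexive)
open import Data.Product using (_,_; proj₁; proj₂)
open import Data.Sum using (_⊎_; inj₁; inj₂)
open import Data.Vec using (_∷_; here; there)
open import Data.Vec.Properties using (lookup∘tabulate; []=⇒lookup; lookup⇒[]=)
open import Function.Bundles using (Equivalence)
open import Relation.Binary.PropositionalEquality
  using (_≡_; refl; sym; trans; cong; subst; module ≡-Reasoning)
open import Relation.Nullary using (¬_; yes; no)

∣p∪⁅x⁆∣≡1+∣p∣ : ∀ {n} (p : Subset n) (x : Fin n) → x ∉ p → ∣ p ∪ ⁅ x ⁆ ∣ ≡ suc ∣ p ∣
∣p∪⁅x⁆∣≡1+∣p∣ (outside ∷ p) Fin.zero    _   = cong suc (cong ∣_∣ (∪-identityʳ p))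
∣p∪⁅x⁆∣≡1+∣p∣ (inside  ∷ p) Fin.zero    x∉p = ⊥-elim (x∉p here)
∣p∪⁅x⁆∣≡1+∣p∣ (outside ∷ p) (Fin.suc x) x∉p = ∣p∪⁅x⁆∣≡1+∣p∣ p x (λ x∈p → x∉p (there x∈p))
∣p∪⁅x⁆∣≡1+∣p∣ (inside  ∷ p) (Fin.suc x) x∉p = cong suc (∣p∪⁅x⁆∣≡1+∣p∣ p x (λ x∈p → x∉p (there x∈p)))

∣Empty∣≡0 : ∀ {n} {p : Subset n} → Empty p → ∣ p ∣ ≡ 0
∣Empty∣≡0 {n} empty = trans (cong ∣_∣ (Empty-unique empty)) (∣⊥∣≡0 n)

x∉p-x : ∀ {n} (p : Subset n) (x : Fin n) → x ∉ p - x
x∉p-x (_ ∷ p) Fin.zero    ()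
x∉p-x (_ ∷ p) (Fin.suc x) (there x∈p-x) = x∉p-x p x x∈p-x

p-x∪⁅x⁆≡p : ∀ {n} {p : Subset n} {x : Fin n} → x ∈ p → (p - x) ∪ ⁅ x ⁆ ≡ p
p-x∪⁅x⁆≡p {p = p} {x} x∈p = ⊆-antisym shrink grow
  where
  shrink : (p - x) ∪ ⁅ x ⁆ ⊆ p
  shrink y∈ with x∈p∪q⁻ (p - x) ⁅ x ⁆ y∈
  ... | inj₁ y∈p-x = p─q⊆p p ⁅ x ⁆ y∈p-x
  ... | inj₂ y∈⁅x⁆ = subst (_∈ p) (sym (x∈⁅y⁆⇒x≡y x y∈⁅x⁆)) x∈p
  grow : p ⊆ (p - x) ∪ ⁅ x ⁆
  grow {y} y∈p with y ≟ x
  ... | yes refl = x∈p∪q⁺ (inj₂ (x∈⁅x⁆ x))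
  ... | no  y≢x  = x∈p∪q⁺ (inj₁ (x∈p∧x≢y⇒x∈p-y y∈p y≢x))

⁅x⁆∩q≡⁅x⁆ : ∀ {n} {q : Subset n} {x : Fin n} → x ∈ q → ⁅ x ⁆ ∩ q ≡ ⁅ x ⁆
⁅x⁆∩q≡⁅x⁆ {q = q} {x} x∈q = ⊆-antisym (p∩q⊆p ⁅ x ⁆ q) into
  where
  into : ⁅ x ⁆ ⊆ ⁅ x ⁆ ∩ q
  into {y} y∈⁅x⁆ with x∈⁅y⁆⇒x≡y x y∈⁅x⁆
  ... | refl = x∈p∩q⁺ (x∈⁅x⁆ x , x∈q)

∈interval⁺ : ∀ {n} k (x : Fin n) → k ≤ suc (toℕ x) → x ∈ interval k
∈interval⁺ k x k≤x = lookup⇒[]= x _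
  (trans (lookup∘tabulate _ x) (Equivalence.to T-≡ (≤⇒≤ᵇ k≤x)))

∈interval⁻ : ∀ {n} k (x : Fin n) → x ∈ interval k → k ≤ suc (toℕ x)
∈interval⁻ k x x∈I = ≤ᵇ⇒≤ k _
  (Equivalence.from T-≡ (trans (sym (lookup∘tabulate _ x)) ([]=⇒lookup x∈I)))

countFrom-insert : ∀ {n} k (p : Subset n) (x : Fin n) →
  x ∉ p → x ∈ interval k → countFrom k (p ∪ ⁅ x ⁆) ≡ suc (countFrom k p)
countFrom-insert k p x x∉p x∈I = begin
  ∣ (p ∪ ⁅ x ⁆) ∩ I ∣         ≡⟨ cong ∣_∣ (∩-distribʳ-∪ I p ⁅ x ⁆) ⟩
  ∣ (p ∩ I) ∪ (⁅ x ⁆ ∩ I) ∣   ≡⟨ cong (λ s → ∣ (p ∩ I) ∪ s ∣) (⁅x⁆∩q≡⁅x⁆ x∈I) ⟩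
  ∣ (p ∩ I) ∪ ⁅ x ⁆ ∣         ≡⟨ ∣p∪⁅x⁆∣≡1+∣p∣ (p ∩ I) x (λ x∈p∩I → x∉p (p∩q⊆p p I x∈p∩I)) ⟩
  suc ∣ p ∩ I ∣               ∎
  where
  open ≡-Reasoning
  I = interval k

countFrom-exchange : ∀ {n} k (p : Subset n) (x y : Fin n) → x ∈ p → y ∉ p - x →
  x ∈ interval k → y ∈ interval k → countFrom k p ≡ countFrom k ((p - x) ∪ ⁅ y ⁆)
countFrom-exchange k p x y x∈p y∉p-x x∈I y∈I = begin
  countFrom k p                   ≡⟨ cong (countFrom k) (sym (p-x∪⁅x⁆≡p x∈p)) ⟩
  countFrom k ((p - x) ∪ ⁅ x ⁆)   ≡⟨ countFrom-insert k (p - x) x (x∉p-x p x) x∈I ⟩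
  suc (countFrom k (p - x))       ≡⟨ sym (countFrom-insert k (p - x) y y∉p-x y∈I) ⟩
  countFrom k ((p - x) ∪ ⁅ y ⁆)   ∎
  where open ≡-Reasoning

countFrom-≤-singleton : ∀ {n} k (p q : Subset n) (x : Fin n) →
  p ∩ interval k ⊆ ⁅ x ⁆ → x ∈ q → countFrom k p ≤ countFrom k q
countFrom-≤-singleton k p q x p∩I⊆⁅x⁆ x∈q = p⊆q⇒∣p∣≤∣q∣ into
  where
  into : p ∩ interval k ⊆ q ∩ interval k
  into {y} y∈p∩I with x∈p∩q⁻ p (interval k) y∈p∩I | x∈⁅y⁆⇒x≡y x (p∩I⊆⁅x⁆ y∈p∩I)
  ... | (_ , y∈I) | refl = x∈p∩q⁺ (x∈q , y∈I)

∪⁅x⁆∩I⊆⁅x⁆ : ∀ {n} (S T I : Subset n) (x : Fin n) →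
  T ⊆ S → Empty (S ∩ I) → (T ∪ ⁅ x ⁆) ∩ I ⊆ ⁅ x ⁆
∪⁅x⁆∩I⊆⁅x⁆ S T I x T⊆S S∩I-empty {y} y∈ with x∈p∩q⁻ (T ∪ ⁅ x ⁆) I y∈
... | (y∈T∪⁅x⁆ , y∈I) with x∈p∪q⁻ T ⁅ x ⁆ y∈T∪⁅x⁆
...   | inj₁ y∈T  = ⊥-elim (S∩I-empty (y , x∈p∩q⁺ (T⊆S y∈T , y∈I)))
...   | inj₂ y∈⁅x⁆ = y∈⁅x⁆

Matches : ∀ {n} → Subset n → Subset n → ℕ → Set
Matches S U k = countFrom k S ≡ countFrom k U ⊎ Empty (S ∩ interval k)

minimum-criterion : ∀ n (S T : Subset (suc n)) → T ⊆ S →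
  (∀ k → Matches S (T ∪ ⁅ topElem n ⁆) k) →
  IsMinimum (Above n S) (T ∪ ⁅ topElem n ⁆)
minimum-criterion n S T T⊆S matches = (top∈U , S≤U) , below
  where
  top = topElem n
  U = T ∪ ⁅ top ⁆

  top∈U : top ∈ U
  top∈U = x∈p∪q⁺ (inj₂ (x∈⁅x⁆ top))

  S≤U : S ≤L U
  S≤U k with matches k
  ... | inj₁ same  = ≤-reflexive same
  ... | inj₂ empty = subst (_≤ countFrom k U) (sym (∣Empty∣≡0 empty)) z≤n

  below : ∀ V → Above n S V → U ≤L V
  below V (top∈V , S≤V) k with matches k
  ... | inj₁ same  = subst (_≤ countFrom k V) same (S≤V k)
  ... | inj₂ empty =
    countFrom-≤-singleton k U V top (∪⁅x⁆∩I⊆⁅x⁆ S T (interval k) top T⊆S empty) top∈V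

⊥-misses : ∀ {n} (I : Subset n) → Empty (⊥ ∩ I)
⊥-misses I (y , y∈⊥∩I) = ∉⊥ (proj₁ (x∈p∩q⁻ ⊥ I y∈⊥∩I))

module WithMaximum {n : ℕ} (S : Subset (suc n)) (m : Fin (suc n)) (max : IsMax S m) where

  -- n itself lies outside S - m: were n ∈ S, then n ≤ m forces m = n.
  top∉S-m : topElem n ∉ S - m
  top∉S-m top∈S-m = x∉p-x S m (subst (_∈ S - m) top≡m top∈S-m)
    where
    top≡m : topElem n ≡ m
    top≡m = ≤-antisym (proj₂ max (topElem n) (p─q⊆p S ⁅ m ⁆ top∈S-m)) (≤fromℕ m)

  low-window : ∀ k → k ≤ suc (toℕ m) → Matches S ((S - m) ∪ ⁅ topElem n ⁆) k
  low-window k k≤m = inj₁ (countFrom-exchange k S m (topElem n) (proj₁ max) top∉S-m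
    (∈interval⁺ k m k≤m) (∈interval⁺ k (topElem n) (≤-trans k≤m (s≤s (≤fromℕ m)))))

  high-window : ∀ k → ¬ (k ≤ suc (toℕ m)) → Matches S ((S - m) ∪ ⁅ topElem n ⁆) k
  high-window k k≰m = inj₂ λ (y , y∈S∩I) →
    let (y∈S , y∈I) = x∈p∩q⁻ S (interval k) y∈S∩I
    in k≰m (≤-trans (∈interval⁻ k y y∈I) (s≤s (proj₂ max y y∈S)))

  matches : ∀ k → Matches S ((S - m) ∪ ⁅ topElem n ⁆) k
  matches k with k ≤? suc (toℕ m)
  ... | yes k≤m = low-window k k≤m
  ... | no  k≰m = high-window k k≰m

corollary3p13 : ∀ (n : ℕ) (S S' : Subset (suc n)) → IsPrimeOf S S' →
    IsMinimum (Above n S) (S' ∪ ⁅ topElem n ⁆)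
corollary3p13 n S S' (inj₁ (refl , refl)) =
  minimum-criterion n ⊥ ⊥ ⊆-refl (λ k → inj₂ (⊥-misses (interval k)))
corollary3p13 n S S' (inj₂ (m , max , refl)) =
  minimum-criterion n S (S - m) (p─q⊆p S ⁅ m ⁆) (WithMaximum.matches S m max)
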